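{- Let $(x_1,\dots,x_8;y_1,\dots,y_8)$ be positive integers satisfying $x_1y_1=x_4+1$, $x_2y_2=x_3+1$, $x_3y_3=x_2+x_4$, $x_4y_4=x_1x_3+x_5$, $x_5y_5=x_4+x_6$, $x_6y_6=x_5+x_7$, $x_7y_7=x_6+x_8$, $x_8y_8=x_7+1$. If $x_4,y_3,y_5,y_6,y_7\ge 2$, then $x_i\le x_4+4$ and $y_i\le x_4+4$ for all $i\in\{1,\dots,8\}$. -}

module Defs where

{-# OPTIONS --safe #-}
-- Read from x₈ leftwards, the equations xᵢyᵢ = xᵢ₋₁ + xᵢ₊₁ with yᵢ ≥ 2 say that
-- the xᵢ are discretely concave: if xᵢ₊₁ ≤ xᵢ + 1 then 2xᵢ ≤ xᵢ₋₁ + xᵢ + 1, so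
-- xᵢ ≤ xᵢ₋₁ + 1. Starting from x₈ ≤ x₇ + 1 this gives xᵢ ≤ x₄ + (i - 4) for
-- i ≥ 5, and in the same way x₃ ≤ x₄ + 1 from x₂ ≤ x₃ + 1. The same inequality
-- xᵢyᵢ ≤ xᵢ₋₁ + xᵢ + 1 bounds yᵢ by xᵢ₋₁ + 2 as soon as xᵢ ≥ 1. Only y₄ needs
-- more: x₄y₄ = x₁x₃ + x₅ ≤ (x₄ + 1)(x₄ + 2) ≤ x₄(x₄ + 4) because x₄ ≥ 2.
module Submission where

open import Defs
open import Data.Nat using (ℕ; _+_; _*_; _≤_; _<_; suc; s≤s; >-nonZero)
open import Data.Nat.Properties
open import Data.Fin using (Fin; #_)
open import Data.Fin.Patterns using (0F; 1F; 2F; 3F; 4F; 5F; 6F; 7F)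
open import Data.Product using (_×_; _,_; map)
open import Relation.Binary.PropositionalEquality using (_≡_; refl; trans; subst; cong)

private
  variable
    m n k l : ℕ

m*n≡k⇒m≤k : 0 < n → m * n ≡ k → m ≤ k
m*n≡k⇒m≤k {n} {m} 0<n refl = m≤m*n m n {{>-nonZero 0<n}}

m*n≡k⇒n≤k : 0 < m → m * n ≡ k → n ≤ k
m*n≡k⇒n≤k {m} {n} 0<m refl = m≤n*m n m {{>-nonZero 0<m}}

m*n≡k+l⇒l≤1+m⇒m≤1+k : 2 ≤ n → m * n ≡ k + l → l ≤ suc m → m ≤ suc k
m*n≡k+l⇒l≤1+m⇒m≤1+k {n} {m} {k} {l} 2≤n eq l≤1+m = +-cancelˡ-≤ m m (suc k) (begin
  m + m     ≡⟨ cong (m +_) (+-identityʳ m) ⟨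
  2 * m     ≤⟨ *-monoˡ-≤ m 2≤n ⟩
  n * m     ≡⟨ *-comm n m ⟩
  m * n     ≡⟨ eq ⟩
  k + l     ≤⟨ +-monoʳ-≤ k l≤1+m ⟩
  k + suc m ≡⟨ +-comm k (suc m) ⟩
  suc m + k ≡⟨ +-suc m k ⟨
  m + suc k ∎)
  where open ≤-Reasoning

k+1+m≤m*[2+k] : 0 < m → k + suc m ≤ m * (2 + k)
k+1+m≤m*[2+k] {suc j} {k} _ = begin
  k + suc (suc j) ≡⟨ +-suc k (suc j) ⟩
  suc (k + suc j) ≡⟨ cong suc (+-suc k j) ⟩
  (2 + k) + j     ≤⟨ +-monoʳ-≤ (2 + k) (m≤m*n j (2 + k)) ⟩
  (2 + k) + j * (2 + k) ∎
  where open ≤-Reasoning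

m*n≡k+l⇒l≤1+m⇒n≤2+k : 0 < m → m * n ≡ k + l → l ≤ suc m → n ≤ 2 + k
m*n≡k+l⇒l≤1+m⇒n≤2+k {m} {n} {k} {l} 0<m eq l≤1+m =
  *-cancelˡ-≤ m {{>-nonZero 0<m}} (begin
    m * n       ≡⟨ eq ⟩
    k + l       ≤⟨ +-monoʳ-≤ k l≤1+m ⟩
    k + suc m   ≤⟨ k+1+m≤m*[2+k] 0<m ⟩
    m * (2 + k) ∎)
  where open ≤-Reasoning

[1+m]*[2+m]≤m*[4+m] : 2 ≤ m → suc m * (2 + m) ≤ m * (4 + m)
[1+m]*[2+m]≤m*[4+m] {m} 2≤m = begin
  (2 + m) + m * (2 + m)   ≤⟨ +-monoˡ-≤ (m * (2 + m)) (+-monoˡ-≤ m 2≤m) ⟩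
  (m + m) + m * (2 + m)   ≡⟨ +-assoc m m (m * (2 + m)) ⟩
  m + (m + m * (2 + m))   ≡⟨ cong (m +_) (*-suc m (2 + m)) ⟨
  m + m * (3 + m)         ≡⟨ *-suc m (3 + m) ⟨
  m * (4 + m)             ∎
  where open ≤-Reasoning

m*n≡p*q+r⇒n≤4+m : ∀ {p q r} → 2 ≤ m → m * n ≡ p * q + r →
                  p ≤ suc m → q ≤ suc m → r ≤ suc m → n ≤ 4 + m
m*n≡p*q+r⇒n≤4+m {m} {n} {p} {q} {r} 2≤m eq p≤1+m q≤1+m r≤1+m =
  *-cancelˡ-≤ m {{>-nonZero (<⇒≤ 2≤m)}} (begin
    m * n                     ≡⟨ eq ⟩
    p * q + r                 ≤⟨ +-mono-≤ (*-mono-≤ p≤1+m q≤1+m) r≤1+m ⟩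
    suc m * suc m + suc m     ≡⟨ +-comm (suc m * suc m) (suc m) ⟩
    suc m + suc m * suc m     ≡⟨ *-suc (suc m) (suc m) ⟨
    suc m * (2 + m)           ≤⟨ [1+m]*[2+m]≤m*[4+m] 2≤m ⟩
    m * (4 + m)               ∎)
  where open ≤-Reasoning

lemma3p1 : (x y : Fin 8 → ℕ) →
    (∀ i → 0 < x i) → (∀ i → 0 < y i) →
    x (# 0) * y (# 0) ≡ x (# 3) + 1 →
    x (# 1) * y (# 1) ≡ x (# 2) + 1 →
    x (# 2) * y (# 2) ≡ x (# 1) + x (# 3) →
    x (# 3) * y (# 3) ≡ x (# 0) * x (# 2) + x (# 4) →
    x (# 4) * y (# 4) ≡ x (# 3) + x (# 5) →
    x (# 5) * y (# 5) ≡ x (# 4) + x (# 6) →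
    x (# 6) * y (# 6) ≡ x (# 5) + x (# 7) →
    x (# 7) * y (# 7) ≡ x (# 6) + 1 →
    2 ≤ x (# 3) → 2 ≤ y (# 2) → 2 ≤ y (# 4) → 2 ≤ y (# 5) → 2 ≤ y (# 6) →
    ∀ i → (x i ≤ x (# 3) + 4) × (y i ≤ x (# 3) + 4)
lemma3p1 x y 0<x 0<y e₁ e₂ e₃ e₄ e₅ e₆ e₇ e₈ 2≤x₄ 2≤y₃ 2≤y₅ 2≤y₆ 2≤y₇ i =
  map (subst (x i ≤_) (+-comm 4 a)) (subst (y i ≤_) (+-comm 4 a)) (bounds i)
  where
  a : ℕ
  a = x 3F
  e₁′ : x 0F * y 0F ≡ suc a
  e₁′ = trans e₁ (+-comm a 1)
  e₂′ : x 1F * y 1F ≡ suc (x 2F)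
  e₂′ = trans e₂ (+-comm (x 2F) 1)
  e₃′ : x 2F * y 2F ≡ a + x 1F
  e₃′ = trans e₃ (+-comm (x 1F) a)
  e₈′ : x 7F * y 7F ≡ suc (x 6F)
  e₈′ = trans e₈ (+-comm (x 6F) 1)

  x₁≤1+a : x 0F ≤ suc a
  x₁≤1+a = m*n≡k⇒m≤k (0<y 0F) e₁′
  x₂≤1+x₃ : x 1F ≤ suc (x 2F)
  x₂≤1+x₃ = m*n≡k⇒m≤k (0<y 1F) e₂′
  x₃≤1+a : x 2F ≤ suc a
  x₃≤1+a = m*n≡k+l⇒l≤1+m⇒m≤1+k 2≤y₃ e₃′ x₂≤1+x₃
  x₈≤1+x₇ : x 7F ≤ suc (x 6F)
  x₈≤1+x₇ = m*n≡k⇒m≤k (0<y 7F) e₈′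
  x₇≤1+x₆ : x 6F ≤ suc (x 5F)
  x₇≤1+x₆ = m*n≡k+l⇒l≤1+m⇒m≤1+k 2≤y₇ e₇ x₈≤1+x₇
  x₆≤1+x₅ : x 5F ≤ suc (x 4F)
  x₆≤1+x₅ = m*n≡k+l⇒l≤1+m⇒m≤1+k 2≤y₆ e₆ x₇≤1+x₆
  x₅≤1+a : x 4F ≤ suc a
  x₅≤1+a = m*n≡k+l⇒l≤1+m⇒m≤1+k 2≤y₅ e₅ x₆≤1+x₅
  x₆≤2+a : x 5F ≤ 2 + a
  x₆≤2+a = ≤-trans x₆≤1+x₅ (s≤s x₅≤1+a)
  x₇≤3+a : x 6F ≤ 3 + a
  x₇≤3+a = ≤-trans x₇≤1+x₆ (s≤s x₆≤2+a)

  bounds : ∀ i → (x i ≤ 4 + a) × (y i ≤ 4 + a)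
  bounds 0F = m≤n⇒m≤o+n 3 x₁≤1+a
            , m≤n⇒m≤o+n 3 (m*n≡k⇒n≤k (0<x 0F) e₁′)
  bounds 1F = m≤n⇒m≤o+n 2 (≤-trans x₂≤1+x₃ (s≤s x₃≤1+a))
            , m≤n⇒m≤o+n 2 (≤-trans (m*n≡k⇒n≤k (0<x 1F) e₂′) (s≤s x₃≤1+a))
  bounds 2F = m≤n⇒m≤o+n 3 x₃≤1+a
            , m≤n⇒m≤o+n 2 (m*n≡k+l⇒l≤1+m⇒n≤2+k (0<x 2F) e₃′ x₂≤1+x₃)
  bounds 3F = m≤n+m a 4
            , m*n≡p*q+r⇒n≤4+m 2≤x₄ e₄ x₁≤1+a x₃≤1+a x₅≤1+a
  bounds 4F = m≤n⇒m≤o+n 3 x₅≤1+a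
            , m≤n⇒m≤o+n 2 (m*n≡k+l⇒l≤1+m⇒n≤2+k (0<x 4F) e₅ x₆≤1+x₅)
  bounds 5F = m≤n⇒m≤o+n 2 x₆≤2+a
            , m≤n⇒m≤o+n 1 (≤-trans (m*n≡k+l⇒l≤1+m⇒n≤2+k (0<x 5F) e₆ x₇≤1+x₆) (+-monoʳ-≤ 2 x₅≤1+a))
  bounds 6F = m≤n⇒m≤o+n 1 x₇≤3+a
            , ≤-trans (m*n≡k+l⇒l≤1+m⇒n≤2+k (0<x 6F) e₇ x₈≤1+x₇) (+-monoʳ-≤ 2 x₆≤2+a)
  bounds 7F = ≤-trans x₈≤1+x₇ (s≤s x₇≤3+a)
            , ≤-trans (m*n≡k⇒n≤k (0<x 7F) e₈′) (s≤s x₇≤3+a)
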